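{- Let $z_1,\ldots,z_m$ be real numbers and $\mu\ge0$ such that $\left|\sum_{i=1}^m z_i\right|\le\mu$ and $\sum_{i=1}^m z_i^2\le\mu^2$. Then for every integer $k\ge2$, $|S_k(z_1,\ldots,z_m)|\le\mu^k$.
   Context: $S_k(z_1,\ldots,z_m)=\sum_{I\subseteq[m],|I|=k}\prod_{i\in I}z_i$ is the $k$-th elementary symmetric polynomial. -}

module Defs where

open import Level using (Level; _⊔_) renaming (suc to lsuc)
open import Data.Nat using (ℕ; zero; suc; _≟_)
open import Data.Fin using (Fin; zero; suc)
open import Data.Fin.Subset using (Subset; inside; outside; ∣_∣)
open import Data.Vec using ([]; _∷_)
open import Data.List using (List; []; _∷_; _++_; map; filter; foldr)
open import Data.Product using (_×_; ∃)
open import Relation.Nullary using (¬_)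
open import Relation.Binary.Structures using (IsTotalOrder)
open import Algebra.Bundles using (CommutativeRing)

record OrderedField (c ℓ₁ ℓ₂ : Level) : Set (lsuc (c ⊔ ℓ₁ ⊔ ℓ₂)) where
  field
    commutativeRing : CommutativeRing c ℓ₁
  open CommutativeRing commutativeRing public
  field
    _≤_          : Carrier → Carrier → Set ℓ₂
    isTotalOrder : IsTotalOrder _≈_ _≤_
    +-mono-≤     : ∀ {x y} z → x ≤ y → (x + z) ≤ (y + z)
    *-nonneg     : ∀ {x y} → 0# ≤ x → 0# ≤ y → 0# ≤ (x * y)
    0≉1          : ¬ (0# ≈ 1#)
    inverse      : ∀ x → ¬ (x ≈ 0#) → ∃ λ y → (x * y) ≈ 1#

allSubsets : ∀ m → List (Subset m)
allSubsets zero    = [] ∷ []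
allSubsets (suc m) = map (inside ∷_) (allSubsets m) ++ map (outside ∷_) (allSubsets m)

module _ {c ℓ₁ ℓ₂} (F : OrderedField c ℓ₁ ℓ₂) where
  open OrderedField F using (Carrier; _+_; _*_; -_; 0#; 1#; _≤_)

  AbsLe : Carrier → Carrier → Set ℓ₂
  AbsLe x μ = ((- μ) ≤ x) × (x ≤ μ)

  sumFin : ∀ {m} → (Fin m → Carrier) → Carrier
  sumFin {zero}  f = 0#
  sumFin {suc m} f = f zero + sumFin (λ i → f (suc i))

  pow : Carrier → ℕ → Carrier
  pow x zero    = 1#
  pow x (suc k) = x * pow x k

  prodSubset : ∀ {m} → (Fin m → Carrier) → Subset m → Carrier
  prodSubset z []             = 1#
  prodSubset z (inside  ∷ p)  = z zero * prodSubset (λ i → z (suc i)) p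
  prodSubset z (outside ∷ p)  = prodSubset (λ i → z (suc i)) p

  S : ∀ {m} → ℕ → (Fin m → Carrier) → Carrier
  S {m} k z = foldr (λ p acc → prodSubset z p + acc) 0#
                (filter (λ p → ∣ p ∣ ≟ k) (allSubsets m))

module Submission where

-- Let e_k = S_k(z) and let q_i = Σ_j (-z_j)^i be the power sums of the
-- negated variables.  Newton's identity reads  k e_k + Σ_{i<k} e_i q_{k-i} = 0.
-- The hypotheses give |q_1| = |Σ z_j| ≤ μ, and for i ≥ 2 each term obeys
-- |z_j^i| ≤ μ^{i-2} z_j^2 (as z_j^2 ≤ Σ z^2 ≤ μ^2), so |q_i| ≤ μ^{i-2} Σ z^2 ≤ μ^i.
-- Strong induction on k then gives  k |e_k| ≤ Σ_{i<k} μ^i μ^{k-i} = k μ^k,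
-- i.e. |e_k| ≤ μ^k (for every k, in particular for k ≥ 2).
--
-- Since an
-- ordered ring may contain square-zero elements, "x² ≤ μ² ⇒ |x| ≤ μ" fails;
-- instead x splits as s + e with |s| ≤ μ, e² = 0 and es = 0, which suffices
-- because x and s then have the same powers of degree ≥ 2.

open import Defs
open import Level using (_⊔_)
open import Data.Nat using (ℕ) renaming (_≤_ to _≤ℕ_)
open import Data.Nat as ℕ using (zero; suc; _<_; s≤s; z≤n)
open import Data.Nat.Induction using (<-rec)
open import Data.Integer as ℤ using (ℤ; +_; -[1+_]; +[1+_])
import Data.Integer.Properties as ℤP
open import Data.Fin using (Fin; zero; suc)
open import Data.Fin.Subset using (Subset; inside; outside; ∣_∣)
open import Data.Vec using (_∷_)
open import Data.List using (List; []; _∷_; _++_; map; filter; foldr)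
open import Data.Bool using (true; false)
open import Data.Maybe using (Maybe; just; nothing)
open import Data.Product using (_×_; _,_; proj₁; proj₂)
open import Data.Sum using (inj₁; inj₂)
open import Relation.Nullary using (yes; no; does)
open import Relation.Binary.PropositionalEquality as ≡ using (_≡_)
open import Relation.Binary.Structures using (IsTotalOrder)
open import Algebra.Bundles using (CommutativeRing)
open import Algebra.Solver.Ring.AlmostCommutativeRing
  using (fromCommutativeRing; _-Raw-AlmostCommutative⟶_)
import Algebra.Solver.Ring as RingSolver

-- The standard library's ring solver needs a coefficient ring with
-- decidable equality mapping into the ring at hand; for an arbitrary
-- commutative ring R this is the canonical morphism ℤ → R.
module IntegerCoefficients {c ℓ} (R : CommutativeRing c ℓ) where
  open CommutativeRing R hiding (zero)
  open import Algebra.Properties.Ring ring using (-‿distribˡ-*; -‿involutive; -0#≈0#)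
  open import Algebra.Properties.AbelianGroup +-abelianGroup using (⁻¹-∙-comm)
  open import Algebra.Properties.Monoid.Mult.TCOptimised +-monoid
    using (1+×) renaming (_×_ to _×ₘ_)
  open import Relation.Binary.Reasoning.Setoid setoid

  fromℕ : ℕ → Carrier
  fromℕ n = n ×ₘ 1#

  fromℕ-suc : ∀ n → fromℕ (suc n) ≈ 1# + fromℕ n
  fromℕ-suc n = 1+× n 1#

  fromℤ : ℤ → Carrier
  fromℤ (+ n)      = fromℕ n
  fromℤ -[1+ n ]   = - fromℕ (suc n)

  -‿cancelˡ : ∀ x y → - x + (x + y) ≈ y
  -‿cancelˡ x y = begin
    - x + (x + y) ≈⟨ sym (+-assoc _ _ _) ⟩
    (- x + x) + y ≈⟨ +-congʳ (-‿inverseˡ x) ⟩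
    0# + y        ≈⟨ +-identityˡ y ⟩
    y             ∎

  fromℤ-suc : ∀ i → fromℤ (ℤ.suc i) ≈ 1# + fromℤ i
  fromℤ-suc (+ n)            = fromℕ-suc n
  fromℤ-suc -[1+ zero ]      = sym (-‿inverseʳ 1#)
  fromℤ-suc -[1+ suc n ]     = begin
    - fromℕ (suc n)                   ≈⟨ sym (-‿cancelˡ (- 1#) _) ⟩
    - - 1# + (- 1# + - fromℕ (suc n)) ≈⟨ +-cong (-‿involutive 1#) (⁻¹-∙-comm 1# _) ⟩
    1# + - (1# + fromℕ (suc n))       ≈⟨ +-congˡ (-‿cong (sym (fromℕ-suc (suc n)))) ⟩
    1# + - fromℕ (suc (suc n))        ∎

  fromℤ-pred : ∀ i → fromℤ (ℤ.pred i) ≈ - 1# + fromℤ i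
  fromℤ-pred i = begin
    fromℤ (ℤ.pred i)                ≈⟨ sym (-‿cancelˡ 1# _) ⟩
    - 1# + (1# + fromℤ (ℤ.pred i))  ≈⟨ +-congˡ (sym (fromℤ-suc (ℤ.pred i))) ⟩
    - 1# + fromℤ (ℤ.suc (ℤ.pred i)) ≡⟨ ≡.cong (λ k → - 1# + fromℤ k) (ℤP.suc-pred i) ⟩
    - 1# + fromℤ i                  ∎

  fromℤ-+ : ∀ i j → fromℤ (i ℤ.+ j) ≈ fromℤ i + fromℤ j
  fromℤ-neg-+ : ∀ n j → fromℤ (ℤ.- (+ n) ℤ.+ j) ≈ fromℤ (ℤ.- (+ n)) + fromℤ j
  fromℤ-+ (+ zero) j = begin
    fromℤ (+ 0 ℤ.+ j) ≡⟨ ≡.cong fromℤ (ℤP.+-identityˡ j) ⟩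
    fromℤ j           ≈⟨ sym (+-identityˡ _) ⟩
    0# + fromℤ j      ∎
  fromℤ-+ +[1+ n ] j = begin
    fromℤ (+[1+ n ] ℤ.+ j)      ≡⟨ ≡.cong fromℤ (ℤP.suc-+ n j) ⟩
    fromℤ (ℤ.suc (+ n ℤ.+ j))   ≈⟨ fromℤ-suc (+ n ℤ.+ j) ⟩
    1# + fromℤ (+ n ℤ.+ j)      ≈⟨ +-congˡ (fromℤ-+ (+ n) j) ⟩
    1# + (fromℕ n + fromℤ j)    ≈⟨ sym (+-assoc _ _ _) ⟩
    (1# + fromℕ n) + fromℤ j    ≈⟨ +-congʳ (sym (fromℕ-suc n)) ⟩
    fromℕ (suc n) + fromℤ j     ∎
  fromℤ-+ -[1+ n ] j = begin
    fromℤ (-[1+ n ] ℤ.+ j)                 ≡⟨ ≡.cong (λ k → fromℤ (k ℤ.+ j)) (ℤP.neg-suc n) ⟩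
    fromℤ (ℤ.pred (ℤ.- (+ n)) ℤ.+ j)       ≡⟨ ≡.cong fromℤ (ℤP.pred-+ (ℤ.- (+ n)) j) ⟩
    fromℤ (ℤ.pred (ℤ.- (+ n) ℤ.+ j))       ≈⟨ fromℤ-pred (ℤ.- (+ n) ℤ.+ j) ⟩
    - 1# + fromℤ (ℤ.- (+ n) ℤ.+ j)         ≈⟨ +-congˡ (fromℤ-neg-+ n j) ⟩
    - 1# + (fromℤ (ℤ.- (+ n)) + fromℤ j)   ≈⟨ sym (+-assoc _ _ _) ⟩
    (- 1# + fromℤ (ℤ.- (+ n))) + fromℤ j   ≈⟨ +-congʳ (sym (fromℤ-pred (ℤ.- (+ n)))) ⟩
    fromℤ (ℤ.pred (ℤ.- (+ n))) + fromℤ j   ≡⟨ ≡.cong (λ k → fromℤ k + fromℤ j) (≡.sym (ℤP.neg-suc n)) ⟩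
    fromℤ -[1+ n ] + fromℤ j               ∎
  fromℤ-neg-+ zero    j = fromℤ-+ (+ zero) j
  fromℤ-neg-+ (suc n) j = fromℤ-+ -[1+ n ] j

  fromℤ-neg : ∀ i → fromℤ (ℤ.- i) ≈ - fromℤ i
  fromℤ-neg (+ zero)  = sym -0#≈0#
  fromℤ-neg +[1+ n ]  = refl
  fromℤ-neg -[1+ n ]  = sym (-‿involutive _)

  fromℤ-*-nat : ∀ n j → fromℤ (+ n ℤ.* j) ≈ fromℕ n * fromℤ j
  fromℤ-*-nat zero    j = sym (zeroˡ _)
  fromℤ-*-nat (suc n) j = begin
    fromℤ (+[1+ n ] ℤ.* j)           ≡⟨ ≡.cong fromℤ (ℤP.suc-* (+ n) j) ⟩
    fromℤ (j ℤ.+ + n ℤ.* j)          ≈⟨ fromℤ-+ j _ ⟩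
    fromℤ j + fromℤ (+ n ℤ.* j)      ≈⟨ +-cong (sym (*-identityˡ _)) (fromℤ-*-nat n j) ⟩
    1# * fromℤ j + fromℕ n * fromℤ j ≈⟨ sym (distribʳ _ _ _) ⟩
    (1# + fromℕ n) * fromℤ j         ≈⟨ *-congʳ (sym (fromℕ-suc n)) ⟩
    fromℕ (suc n) * fromℤ j          ∎

  fromℤ-* : ∀ i j → fromℤ (i ℤ.* j) ≈ fromℤ i * fromℤ j
  fromℤ-* (+ n)    j = fromℤ-*-nat n j
  fromℤ-* -[1+ n ] j = begin
    fromℤ (-[1+ n ] ℤ.* j)          ≡⟨ ≡.cong fromℤ (≡.sym (ℤP.neg-distribˡ-* +[1+ n ] j)) ⟩
    fromℤ (ℤ.- (+[1+ n ] ℤ.* j))    ≈⟨ fromℤ-neg (+[1+ n ] ℤ.* j) ⟩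
    - fromℤ (+[1+ n ] ℤ.* j)        ≈⟨ -‿cong (fromℤ-*-nat (suc n) j) ⟩
    - (fromℕ (suc n) * fromℤ j)     ≈⟨ -‿distribˡ-* _ _ ⟩
    - fromℕ (suc n) * fromℤ j       ∎

  fromℤ-morphism : ℤ.+-*-rawRing -Raw-AlmostCommutative⟶ fromCommutativeRing R
  fromℤ-morphism = record
    { ⟦_⟧ = fromℤ ; +-homo = fromℤ-+ ; *-homo = fromℤ-* ; -‿homo = fromℤ-neg
    ; 0-homo = refl ; 1-homo = refl }

  _≟-coeff_ : ∀ i j → Maybe (fromℤ i ≈ fromℤ j)
  i ≟-coeff j with i ℤ.≟ j
  ... | yes ≡.refl = just refl
  ... | no _       = nothing

  open RingSolver ℤ.+-*-rawRing (fromCommutativeRing R) fromℤ-morphism _≟-coeff_ public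
    using (solve; _:=_; _:+_; _:*_; :-_; _:-_; con)

module Bounds {c ℓ₁ ℓ₂} (F : OrderedField c ℓ₁ ℓ₂) where
  open OrderedField F hiding (zero)
  open IntegerCoefficients commutativeRing
    using (fromℕ; fromℕ-suc; solve; _:=_; _:+_; _:*_; :-_; _:-_; con)
  open import Algebra.Properties.Ring ring using (-0#≈0#)
  open import Algebra.Properties.AbelianGroup +-abelianGroup using (⁻¹-∙-comm)
  open import Relation.Binary.Reasoning.Setoid setoid
  module ≤ = IsTotalOrder isTotalOrder

  neg-*-neg : ∀ a b → - a * - b ≈ a * b
  neg-*-neg = solve 2 (λ a b → :- a :* :- b := a :* b) refl

  neg-square : ∀ x → - x * - x ≈ x * x
  neg-square x = neg-*-neg x x

  NonNeg : Carrier → Set ℓ₂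
  NonNeg x = 0# ≤ x

  ≤-resp-≈ : ∀ {x x′ y y′} → x ≈ x′ → y ≈ y′ → x ≤ y → x′ ≤ y′
  ≤-resp-≈ x≈x′ y≈y′ x≤y = ≤.≤-respˡ-≈ x≈x′ (≤.≤-respʳ-≈ y≈y′ x≤y)

  nonneg-resp : ∀ {a b} → a ≈ b → NonNeg a → NonNeg b
  nonneg-resp = ≤.≤-respʳ-≈

  ≤⇒nonneg : ∀ {x y} → x ≤ y → NonNeg (y - x)
  ≤⇒nonneg {x} x≤y = ≤.≤-respˡ-≈ (-‿inverseʳ x) (+-mono-≤ (- x) x≤y)

  nonneg⇒≤ : ∀ {x y} → NonNeg (y - x) → x ≤ y
  nonneg⇒≤ {x} {y} h =
    ≤-resp-≈ (+-identityˡ x) (solve 2 (λ x y → (y :- x) :+ x := y) refl x y) (+-mono-≤ x h)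

  nonpos⇒nonneg-neg : ∀ {x} → x ≤ 0# → NonNeg (- x)
  nonpos⇒nonneg-neg {x} x≤0 = nonneg-resp (+-identityˡ (- x)) (≤⇒nonneg x≤0)

  nonneg-+ : ∀ {a b} → NonNeg a → NonNeg b → NonNeg (a + b)
  nonneg-+ {a} {b} a≥0 b≥0 =
    ≤.trans a≥0 (≤-resp-≈ (+-identityˡ a) (+-comm b a) (+-mono-≤ a b≥0))

  nonneg-square : ∀ x → NonNeg (x * x)
  nonneg-square x with ≤.total 0# x
  ... | inj₁ x≥0 = *-nonneg x≥0 x≥0
  ... | inj₂ x≤0 = nonneg-resp (neg-square x) (*-nonneg -x≥0 -x≥0)
    where -x≥0 = nonpos⇒nonneg-neg x≤0

  nonneg-1 : NonNeg 1#
  nonneg-1 = nonneg-resp (*-identityˡ 1#) (nonneg-square 1#)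

  nonneg-fromℕ : ∀ n → NonNeg (fromℕ n)
  nonneg-fromℕ zero    = ≤.refl
  nonneg-fromℕ (suc n) = nonneg-resp (sym (fromℕ-suc n)) (nonneg-+ nonneg-1 (nonneg-fromℕ n))

  *-monoˡ-≤ : ∀ {c a b} → NonNeg c → a ≤ b → (c * a) ≤ (c * b)
  *-monoˡ-≤ {c} {a} {b} c≥0 a≤b = nonneg⇒≤ (nonneg-resp
    (solve 3 (λ c a b → c :* (b :- a) := c :* b :- c :* a) refl c a b)
    (*-nonneg c≥0 (≤⇒nonneg a≤b)))

  nonneg-antisym : ∀ {a} → NonNeg a → NonNeg (- a) → a ≈ 0#
  nonneg-antisym {a} a≥0 -a≥0 =
    ≤.antisym (nonneg⇒≤ (nonneg-resp (sym (+-identityˡ (- a))) -a≥0)) a≥0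

  nonneg-sum-vanishes : ∀ {a b} → NonNeg a → NonNeg b → NonNeg (- (a + b)) → a ≈ 0#
  nonneg-sum-vanishes {a} {b} a≥0 b≥0 sum≤0 = nonneg-antisym a≥0 (nonneg-resp
    (solve 2 (λ a b → b :+ :- (a :+ b) := :- a) refl a b) (nonneg-+ b≥0 sum≤0))

  nonneg-cancel : ∀ k {t} → NonNeg (fromℕ (suc k) * t) → NonNeg t
  nonneg-cancel k {t} h with ≤.total 0# t
  ... | inj₁ t≥0 = t≥0
  ... | inj₂ t≤0 = nonneg-resp t≈
          (nonneg-+ h (*-nonneg (nonneg-fromℕ k) (nonpos⇒nonneg-neg t≤0)))
    where
    t≈ : fromℕ (suc k) * t + fromℕ k * - t ≈ t
    t≈ = trans (+-congʳ (*-congʳ (fromℕ-suc k)))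
               (solve 2 (λ n t → (con (+ 1) :+ n) :* t :+ n :* :- t := t) refl (fromℕ k) t)

  infix 4 ∣_∣≤_
  ∣_∣≤_ : Carrier → Carrier → Set ℓ₂
  ∣ y ∣≤ B = AbsLe F y B

  abs-intro : ∀ {y B} → NonNeg (B + y) → NonNeg (B - y) → ∣ y ∣≤ B
  abs-intro {y} {B} lower upper =
    nonneg⇒≤ (nonneg-resp (solve 2 (λ y B → B :+ y := y :- :- B) refl y B) lower) ,
    nonneg⇒≤ upper

  abs-lower : ∀ {y B} → ∣ y ∣≤ B → NonNeg (B + y)
  abs-lower {y} {B} (-B≤y , _) =
    nonneg-resp (solve 2 (λ y B → y :- :- B := B :+ y) refl y B) (≤⇒nonneg -B≤y)

  abs-upper : ∀ {y B} → ∣ y ∣≤ B → NonNeg (B - y)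
  abs-upper (_ , y≤B) = ≤⇒nonneg y≤B

  abs-resp : ∀ {y y′ B B′} → y ≈ y′ → B ≈ B′ → ∣ y ∣≤ B → ∣ y′ ∣≤ B′
  abs-resp y≈ B≈ h = abs-intro (nonneg-resp (+-cong B≈ y≈) (abs-lower h))
                               (nonneg-resp (+-cong B≈ (-‿cong y≈)) (abs-upper h))

  abs-refl : ∀ {B} → NonNeg B → ∣ B ∣≤ B
  abs-refl {B} B≥0 = abs-intro (nonneg-+ B≥0 B≥0) (nonneg-resp (sym (-‿inverseʳ B)) ≤.refl)

  abs-neg : ∀ {y B} → ∣ y ∣≤ B → ∣ - y ∣≤ B
  abs-neg {y} {B} h =
    abs-intro (nonneg-resp (solve 2 (λ y B → B :- y := B :+ :- y) refl y B) (abs-upper h))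
              (nonneg-resp (solve 2 (λ y B → B :+ y := B :- :- y) refl y B) (abs-lower h))

  abs-+ : ∀ {y u A B} → ∣ y ∣≤ A → ∣ u ∣≤ B → ∣ y + u ∣≤ A + B
  abs-+ {y} {u} {A} {B} h k = abs-intro
    (nonneg-resp (solve 4 (λ y u A B → (A :+ y) :+ (B :+ u) := (A :+ B) :+ (y :+ u)) refl y u A B)
                 (nonneg-+ (abs-lower h) (abs-lower k)))
    (nonneg-resp (solve 4 (λ y u A B → (A :- y) :+ (B :- u) := (A :+ B) :- (y :+ u)) refl y u A B)
                 (nonneg-+ (abs-upper h) (abs-upper k)))

  -- 2(AB ± yu) = (A ± y)(B + u) + (A ∓ y)(B - u) is a sum of products of nonnegatives
  abs-* : ∀ {y u A B} → ∣ y ∣≤ A → ∣ u ∣≤ B → ∣ y * u ∣≤ A * B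
  abs-* {y} {u} {A} {B} h k = abs-intro
    (nonneg-cancel 1 (nonneg-resp
      (solve 4 (λ y u A B → (A :+ y) :* (B :+ u) :+ (A :- y) :* (B :- u)
                         := con (+ 2) :* (A :* B :+ y :* u)) refl y u A B)
      (nonneg-+ (*-nonneg (abs-lower h) (abs-lower k)) (*-nonneg (abs-upper h) (abs-upper k)))))
    (nonneg-cancel 1 (nonneg-resp
      (solve 4 (λ y u A B → (A :+ y) :* (B :- u) :+ (A :- y) :* (B :+ u)
                         := con (+ 2) :* (A :* B :- y :* u)) refl y u A B)
      (nonneg-+ (*-nonneg (abs-lower h) (abs-upper k)) (*-nonneg (abs-upper h) (abs-lower k)))))

  abs-mono : ∀ {y A B} → ∣ y ∣≤ A → A ≤ B → ∣ y ∣≤ B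
  abs-mono {y} {A} {B} h A≤B = abs-intro
    (nonneg-resp (solve 3 (λ y A B → (A :+ y) :+ (B :- A) := B :+ y) refl y A B)
                 (nonneg-+ (abs-lower h) (≤⇒nonneg A≤B)))
    (nonneg-resp (solve 3 (λ y A B → (A :- y) :+ (B :- A) := B :- y) refl y A B)
                 (nonneg-+ (abs-upper h) (≤⇒nonneg A≤B)))

  abs-pow : ∀ {y B} → ∣ y ∣≤ B → ∀ i → ∣ pow F y i ∣≤ pow F B i
  abs-pow h zero    = abs-refl nonneg-1
  abs-pow h (suc i) = abs-* h (abs-pow h i)

  abs-cancel : ∀ k {y B} → ∣ fromℕ (suc k) * y ∣≤ fromℕ (suc k) * B → ∣ y ∣≤ B
  abs-cancel k {y} {B} h = abs-intro
    (nonneg-cancel k (nonneg-resp (solve 3 (λ N y B → N :* B :+ N :* y := N :* (B :+ y)) refl N y B)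
                                  (abs-lower h)))
    (nonneg-cancel k (nonneg-resp (solve 3 (λ N y B → N :* B :- N :* y := N :* (B :- y)) refl N y B)
                                  (abs-upper h)))
    where N = fromℕ (suc k)

  -- If d, μ ≥ 0 and (μ + d)² ≤ μ², then d² = 0 and dμ = 0:
  -- indeed μ² - (μ + d)² = -(d² + 2dμ) with d², dμ ≥ 0.
  excess-vanishes : ∀ {d μ} → NonNeg d → NonNeg μ → ((μ + d) * (μ + d)) ≤ (μ * μ) →
                    (d * d ≈ 0#) × (d * μ ≈ 0#)
  excess-vanishes {d} {μ} d≥0 μ≥0 h =
    nonneg-sum-vanishes (nonneg-square d) (nonneg-+ dμ≥0 dμ≥0) defect ,
    nonneg-sum-vanishes dμ≥0 (nonneg-+ (nonneg-square d) dμ≥0) (nonneg-resp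
      (solve 2 (λ d μ → :- (d :* d :+ (d :* μ :+ d :* μ)) := :- (d :* μ :+ (d :* d :+ d :* μ)))
             refl d μ) defect)
    where
    dμ≥0 = *-nonneg d≥0 μ≥0
    defect : NonNeg (- (d * d + (d * μ + d * μ)))
    defect = nonneg-resp
      (solve 2 (λ d μ → μ :* μ :- (μ :+ d) :* (μ :+ d) := :- (d :* d :+ (d :* μ :+ d :* μ)))
             refl d μ)
      (≤⇒nonneg h)

  record Splitting (x μ : Carrier) : Set (c ⊔ ℓ₁ ⊔ ℓ₂) where
    field
      s e     : Carrier
      bounded : ∣ s ∣≤ μ
      split   : x ≈ s + e
      e²≈0    : e * e ≈ 0#
      es≈0    : e * s ≈ 0#

  -- x² ≤ μ² gives such a splitting: s = ±μ when x lies beyond ±μ, else s = x.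
  splitting : ∀ {x μ} → NonNeg μ → (x * x) ≤ (μ * μ) → Splitting x μ
  splitting {x} {μ} μ≥0 x²≤μ² with ≤.total μ x
  ... | inj₁ μ≤x = record
    { s = μ ; e = d ; bounded = abs-refl μ≥0
    ; split = split ; e²≈0 = proj₁ vanish ; es≈0 = proj₂ vanish }
    where
    d = x - μ
    split : x ≈ μ + d
    split = solve 2 (λ x μ → x := μ :+ (x :- μ)) refl x μ
    vanish = excess-vanishes (≤⇒nonneg μ≤x) μ≥0 (≤-resp-≈ (*-cong split split) refl x²≤μ²)
  ... | inj₂ x≤μ with ≤.total (- μ) x
  ...   | inj₁ -μ≤x = record
    { s = x ; e = 0# ; bounded = -μ≤x , x≤μ
    ; split = sym (+-identityʳ x) ; e²≈0 = zeroˡ 0# ; es≈0 = zeroˡ x }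
  ...   | inj₂ x≤-μ = record
    { s = - μ ; e = - d ; bounded = abs-neg (abs-refl μ≥0)
    ; split = solve 2 (λ x μ → x := :- μ :+ :- (:- μ :- x)) refl x μ
    ; e²≈0 = trans (neg-square d) (proj₁ vanish)
    ; es≈0 = trans (neg-*-neg d μ) (proj₂ vanish) }
    where
    d = - μ - x
    vanish = excess-vanishes (≤⇒nonneg x≤-μ) μ≥0 (≤-resp-≈
      (solve 2 (λ x μ → x :* x := (μ :+ (:- μ :- x)) :* (μ :+ (:- μ :- x))) refl x μ) refl x²≤μ²)

  square-zero-perturbation : ∀ {x s e} → x ≈ s + e → e * e ≈ 0# → e * s ≈ 0# →
                             ∀ n → pow F x (suc (suc n)) ≈ pow F s (suc (suc n))
  square-zero-perturbation {x} {s} {e} x≈s+e e²≈0 es≈0 zero = begin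
    x * (x * 1#)
      ≈⟨ *-cong x≈s+e (*-congʳ x≈s+e) ⟩
    (s + e) * ((s + e) * 1#)
      ≈⟨ solve 2 (λ s e → (s :+ e) :* ((s :+ e) :* con (+ 1))
                        := s :* (s :* con (+ 1)) :+ (e :* e :+ (e :* s :+ e :* s))) refl s e ⟩
    s * (s * 1#) + (e * e + (e * s + e * s))
      ≈⟨ +-congˡ (+-cong e²≈0 (+-cong es≈0 es≈0)) ⟩
    s * (s * 1#) + (0# + (0# + 0#))
      ≈⟨ +-congˡ (trans (+-identityˡ _) (+-identityˡ 0#)) ⟩
    s * (s * 1#) + 0#
      ≈⟨ +-identityʳ _ ⟩
    s * (s * 1#) ∎
  square-zero-perturbation {x} {s} {e} x≈s+e e²≈0 es≈0 (suc n) = begin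
    x * pow F x (suc (suc n))
      ≈⟨ *-cong x≈s+e (square-zero-perturbation x≈s+e e²≈0 es≈0 n) ⟩
    (s + e) * (s * (s * P))
      ≈⟨ solve 3 (λ s e P → (s :+ e) :* (s :* (s :* P))
                          := s :* (s :* (s :* P)) :+ (e :* s) :* (s :* P)) refl s e P ⟩
    s * (s * (s * P)) + (e * s) * (s * P)
      ≈⟨ +-congˡ (*-congʳ es≈0) ⟩
    s * (s * (s * P)) + 0# * (s * P)
      ≈⟨ trans (+-congˡ (zeroˡ _)) (+-identityʳ _) ⟩
    s * (s * (s * P)) ∎
    where P = pow F s n

  pow-bound : ∀ {x μ} → NonNeg μ → (x * x) ≤ (μ * μ) →
              ∀ i → ∣ pow F x (suc (suc i)) ∣≤ pow F μ i * (x * x)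
  pow-bound {x} {μ} μ≥0 x²≤μ² i = abs-resp pow-eq (*-congˡ square-eq) bound
    where
    open Splitting (splitting μ≥0 x²≤μ²)
    same-powers = square-zero-perturbation split e²≈0 es≈0
    square-eq : s * s ≈ x * x
    square-eq = begin
      s * s        ≈⟨ *-congˡ (sym (*-identityʳ s)) ⟩
      pow F s 2    ≈⟨ sym (same-powers 0) ⟩
      pow F x 2    ≈⟨ *-congˡ (*-identityʳ x) ⟩
      x * x        ∎
    pow-eq : pow F s i * (s * s) ≈ pow F x (suc (suc i))
    pow-eq = trans (solve 2 (λ s P → P :* (s :* s) := s :* (s :* P)) refl s (pow F s i))
                   (sym (same-powers i))
    bound : ∣ pow F s i * (s * s) ∣≤ pow F μ i * (s * s)
    bound = abs-* (abs-pow bounded i) (abs-refl (nonneg-square s))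

  ∑ : ∀ {m} → (Fin m → Carrier) → Carrier
  ∑ = sumFin F

  sum-cong : ∀ {m} {f g : Fin m → Carrier} → (∀ j → f j ≈ g j) → ∑ f ≈ ∑ g
  sum-cong {zero}  f≈g = refl
  sum-cong {suc m} f≈g = +-cong (f≈g zero) (sum-cong (λ j → f≈g (suc j)))

  sum-neg : ∀ {m} (f : Fin m → Carrier) → ∑ (λ j → - f j) ≈ - ∑ f
  sum-neg {zero}  f = sym -0#≈0#
  sum-neg {suc m} f = trans (+-congˡ (sum-neg (λ j → f (suc j)))) (⁻¹-∙-comm (f zero) _)

  sum-scale : ∀ {m} a (f : Fin m → Carrier) → ∑ (λ j → a * f j) ≈ a * ∑ f
  sum-scale {zero}  a f = sym (zeroʳ a)
  sum-scale {suc m} a f = trans (+-congˡ (sum-scale a (λ j → f (suc j)))) (sym (distribˡ a _ _))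

  sum-nonneg : ∀ {m} {f : Fin m → Carrier} → (∀ j → NonNeg (f j)) → NonNeg (∑ f)
  sum-nonneg {zero}  f≥0 = ≤.refl
  sum-nonneg {suc m} f≥0 = nonneg-+ (f≥0 zero) (sum-nonneg (λ j → f≥0 (suc j)))

  sum-abs : ∀ {m} {f g : Fin m → Carrier} → (∀ j → ∣ f j ∣≤ g j) → ∣ ∑ f ∣≤ ∑ g
  sum-abs {zero}  f≤g = abs-refl ≤.refl
  sum-abs {suc m} f≤g = abs-+ (f≤g zero) (sum-abs (λ j → f≤g (suc j)))

  term≤sum : ∀ {m} {f : Fin m → Carrier} → (∀ j → NonNeg (f j)) → ∀ j → f j ≤ ∑ f
  term≤sum {suc m} {f} f≥0 zero    = nonneg⇒≤ (nonneg-resp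
    (solve 2 (λ a s → s := (a :+ s) :- a) refl (f zero) _) (sum-nonneg (λ j → f≥0 (suc j))))
  term≤sum {suc m} {f} f≥0 (suc j) = ≤.trans (term≤sum (λ j → f≥0 (suc j)) j) (nonneg⇒≤ (nonneg-resp
    (solve 2 (λ a s → a := (a :+ s) :- s) refl (f zero) _) (f≥0 zero)))

  -- Power sums of the negated variables, q_i = Σ_j (-z_j)^i; with this
  -- sign convention Newton's identity has no alternating signs.
  negPowerSum : ∀ {m} → (Fin m → Carrier) → ℕ → Carrier
  negPowerSum z i = ∑ (λ j → pow F (- z j) i)

  negPowerSum-bound : ∀ {m} (z : Fin m → Carrier) μ → NonNeg μ → ∣ ∑ z ∣≤ μ →
                      ∑ (λ j → z j * z j) ≤ (μ * μ) →
                      ∀ i → ∣ negPowerSum z (suc i) ∣≤ pow F μ (suc i)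
  negPowerSum-bound z μ μ≥0 sum≤μ squares≤μ² zero =
    abs-resp (sym (trans (sum-cong (λ j → *-identityʳ (- z j))) (sum-neg z)))
             (sym (*-identityʳ μ)) (abs-neg sum≤μ)
  negPowerSum-bound z μ μ≥0 sum≤μ squares≤μ² (suc i) =
    abs-resp refl (solve 2 (λ μ P → P :* (μ :* μ) := μ :* (μ :* P)) refl μ (pow F μ i))
      (abs-mono (abs-resp refl (sum-scale (pow F μ i) (λ j → z j * z j)) (sum-abs term-bound))
                (*-monoˡ-≤ (nonneg-pow i) squares≤μ²))
    where
    nonneg-pow : ∀ n → NonNeg (pow F μ n)
    nonneg-pow zero    = nonneg-1
    nonneg-pow (suc n) = *-nonneg μ≥0 (nonneg-pow n)
    -- each (-z_j)² ≤ Σ z² ≤ μ², so the single-variable estimate applies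
    term-square : ∀ j → (- z j * - z j) ≤ (μ * μ)
    term-square j = ≤-resp-≈ (sym (neg-square (z j))) refl
      (≤.trans (term≤sum (λ j → nonneg-square (z j)) j) squares≤μ²)
    term-bound : ∀ j → ∣ pow F (- z j) (suc (suc i)) ∣≤ pow F μ i * (z j * z j)
    term-bound j = abs-resp refl (*-congˡ (neg-square (z j))) (pow-bound μ≥0 (term-square j) i)

  -- The sequence (0, e₀, e₁, …), i.e. a generating series multiplied by t.
  shift : (ℕ → Carrier) → ℕ → Carrier
  shift e zero    = 0#
  shift e (suc k) = e k

  -- Elementary symmetric polynomials by the recursion on the variables
  -- e_k(a, w) = e_k(w) + a e_{k-1}(w), i.e. ∏ (1 + z_j t) = (1 + a t) ∏ (1 + w_j t).
  elementary : ∀ {m} → (Fin m → Carrier) → ℕ → Carrier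
  elementary {zero}  z zero    = 1#
  elementary {zero}  z (suc k) = 0#
  elementary {suc m} z k = elementary w k + z zero * shift (elementary w) k
    where w = λ j → z (suc j)

  elementary-zero : ∀ {m} (z : Fin m → Carrier) → elementary z 0 ≈ 1#
  elementary-zero {zero}  z = refl
  elementary-zero {suc m} z =
    trans (+-cong (elementary-zero (λ j → z (suc j))) (zeroʳ (z zero))) (+-identityʳ 1#)

  -- conv k e q = Σ_{i<k} e_i q_{k-i}, the coefficient of t^k in the
  -- product of the series e and q (q₀ does not occur).
  conv : ℕ → (ℕ → Carrier) → (ℕ → Carrier) → Carrier
  conv zero    e q = 0#
  conv (suc k) e q = e zero * q (suc k) + conv k (λ i → e (suc i)) q

  conv-+ˡ : ∀ k (e f q : ℕ → Carrier) → conv k (λ i → e i + f i) q ≈ conv k e q + conv k f q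
  conv-+ˡ zero    e f q = sym (+-identityʳ 0#)
  conv-+ˡ (suc k) e f q =
    trans (+-congˡ (conv-+ˡ k (λ i → e (suc i)) (λ i → f (suc i)) q))
          (solve 5 (λ a b Q X Y → (a :+ b) :* Q :+ (X :+ Y) := (a :* Q :+ X) :+ (b :* Q :+ Y))
                 refl (e zero) (f zero) (q (suc k)) _ _)

  conv-*ˡ : ∀ k a (e q : ℕ → Carrier) → conv k (λ i → a * e i) q ≈ a * conv k e q
  conv-*ˡ zero    a e q = sym (zeroʳ a)
  conv-*ˡ (suc k) a e q =
    trans (+-congˡ (conv-*ˡ k a (λ i → e (suc i)) q))
          (solve 4 (λ a b Q X → a :* b :* Q :+ a :* X := a :* (b :* Q :+ X))
                 refl a (e zero) (q (suc k)) _)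

  conv-+ʳ : ∀ k (e q r : ℕ → Carrier) → conv k e (λ i → q i + r i) ≈ conv k e q + conv k e r
  conv-+ʳ zero    e q r = sym (+-identityʳ 0#)
  conv-+ʳ (suc k) e q r =
    trans (+-congˡ (conv-+ʳ k (λ i → e (suc i)) q r))
          (solve 5 (λ a Q R X Y → a :* (Q :+ R) :+ (X :+ Y) := (a :* Q :+ X) :+ (a :* R :+ Y))
                 refl (e zero) (q (suc k)) (r (suc k)) _ _)

  conv-zeroʳ : ∀ k (e : ℕ → Carrier) → conv k e (λ _ → 0#) ≈ 0#
  conv-zeroʳ zero    e = refl
  conv-zeroʳ (suc k) e = trans (+-cong (zeroʳ (e zero)) (conv-zeroʳ k (λ i → e (suc i))))
                               (+-identityʳ 0#)

  conv-shift : ∀ k (e q : ℕ → Carrier) → conv (suc k) (shift e) q ≈ conv k e q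
  conv-shift k e q = trans (+-congʳ (zeroˡ (q (suc k)))) (+-identityˡ _)

  conv-geometric : ∀ k (e : ℕ → Carrier) b →
                   conv (suc k) e (pow F b) ≈ b * conv k e (pow F b) + e k * b
  conv-geometric zero    e b = solve 2 (λ a b → a :* (b :* con (+ 1)) :+ con (+ 0)
                                           := b :* con (+ 0) :+ a :* b) refl (e zero) b
  conv-geometric (suc k) e b =
    trans (+-congˡ (conv-geometric k (λ i → e (suc i)) b))
          (solve 5 (λ a P b C eₖ → a :* (b :* P) :+ (b :* C :+ eₖ :* b)
                                 := b :* (a :* P :+ C) :+ eₖ :* b)
                 refl (e zero) (pow F b (suc k)) b (conv k (λ i → e (suc i)) (pow F b)) (e (suc k)))

  conv-cons : ∀ {m} (z : Fin (suc m) → Carrier) k →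
              let w = λ j → z (suc j) ; e = elementary w ; q = negPowerSum w in
              conv (suc k) (elementary z) (negPowerSum z) ≈ conv (suc k) e q + z zero * (conv k e q - e k)
  conv-cons z k = begin
    conv (suc k) (elementary z) (negPowerSum z)
      ≈⟨ conv-+ˡ (suc k) e (λ i → a * shift e i) _ ⟩
    conv (suc k) e (negPowerSum z) + conv (suc k) (λ i → a * shift e i) (negPowerSum z)
      ≈⟨ +-cong (conv-+ʳ (suc k) e (pow F (- a)) q) (conv-*ˡ (suc k) a (shift e) _) ⟩
    (conv (suc k) e (pow F (- a)) + conv (suc k) e q) + a * conv (suc k) (shift e) (negPowerSum z)
      ≈⟨ +-cong (+-congʳ (conv-geometric k e (- a))) (*-congˡ (conv-+ʳ (suc k) (shift e) (pow F (- a)) q)) ⟩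
    (- a * X + e k * - a + conv (suc k) e q) + a * (conv (suc k) (shift e) (pow F (- a)) + conv (suc k) (shift e) q)
      ≈⟨ +-congˡ (*-congˡ (+-cong (conv-shift k e _) (conv-shift k e q))) ⟩
    (- a * X + e k * - a + conv (suc k) e q) + a * (X + conv k e q)
      ≈⟨ solve 5 (λ a X eₖ Y₁ Y₀ → (:- a :* X :+ eₖ :* :- a :+ Y₁) :+ a :* (X :+ Y₀)
                                 := Y₁ :+ a :* (Y₀ :- eₖ)) refl a X (e k) _ _ ⟩
    conv (suc k) e q + a * (conv k e q - e k) ∎
    where
    a = z zero
    w = λ j → z (suc j)
    e = elementary w
    q = negPowerSum w
    X = conv k e (pow F (- a))

  newton : ∀ {m} (z : Fin m → Carrier) k →
           fromℕ k * elementary z k + conv k (elementary z) (negPowerSum z) ≈ 0#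
  newton {zero}  z zero    = solve 0 (con (+ 0) :* con (+ 1) :+ con (+ 0) := con (+ 0)) refl
  newton {zero}  z (suc k) = trans (+-cong (zeroʳ _) (conv-zeroʳ (suc k) (elementary z))) (+-identityˡ 0#)
  newton {suc m} z zero    = trans (+-identityʳ _) (zeroˡ _)
  newton {suc m} z (suc k) = begin
    fromℕ (suc k) * (e (suc k) + a * e k) + conv (suc k) (elementary z) (negPowerSum z)
      ≈⟨ +-cong (*-congʳ (fromℕ-suc k)) (conv-cons z k) ⟩
    (1# + n) * (e (suc k) + a * e k) + (Y₁ + a * (Y₀ - e k))
      ≈⟨ solve 6 (λ n e₁ e₀ a Y₁ Y₀ → (con (+ 1) :+ n) :* (e₁ :+ a :* e₀) :+ (Y₁ :+ a :* (Y₀ :- e₀))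
                                    := ((con (+ 1) :+ n) :* e₁ :+ Y₁) :+ a :* (n :* e₀ :+ Y₀))
                 refl n (e (suc k)) (e k) a Y₁ Y₀ ⟩
    ((1# + n) * e (suc k) + Y₁) + a * (n * e k + Y₀)
      ≈⟨ +-cong (trans (+-congʳ (*-congʳ (sym (fromℕ-suc k)))) (newton w (suc k)))
                (*-congˡ (newton w k)) ⟩
    0# + a * 0#
      ≈⟨ trans (+-identityˡ _) (zeroʳ a) ⟩
    0# ∎
    where
    a = z zero
    w = λ j → z (suc j)
    e = elementary w
    n = fromℕ k
    Y₁ = conv (suc k) e (negPowerSum w)
    Y₀ = conv k e (negPowerSum w)

  conv-bound : ∀ (q : ℕ → Carrier) μ → NonNeg μ → (∀ i → ∣ q (suc i) ∣≤ pow F μ (suc i)) →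
               ∀ k (e : ℕ → Carrier) b → NonNeg b → (∀ {j} → j < k → ∣ e j ∣≤ b * pow F μ j) →
               ∣ conv k e q ∣≤ fromℕ k * (b * pow F μ k)
  conv-bound q μ μ≥0 q-bound zero    e b b≥0 e-bound = abs-resp refl (sym (zeroˡ _)) (abs-refl ≤.refl)
  conv-bound q μ μ≥0 q-bound (suc k) e b b≥0 e-bound =
    abs-resp refl total (abs-+ (abs-* (e-bound (s≤s z≤n)) (q-bound k))
                               (conv-bound q μ μ≥0 q-bound k (λ i → e (suc i)) (b * μ) (*-nonneg b≥0 μ≥0)
                                 (λ j<k → abs-resp refl (sym (*-assoc b μ _)) (e-bound (s≤s j<k)))))
    where
    total : b * 1# * pow F μ (suc k) + fromℕ k * (b * μ * pow F μ k) ≈ fromℕ (suc k) * (b * pow F μ (suc k))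
    total = trans (solve 4 (λ b μ P n → b :* con (+ 1) :* (μ :* P) :+ n :* (b :* μ :* P)
                                      := (con (+ 1) :+ n) :* (b :* (μ :* P))) refl b μ (pow F μ k) (fromℕ k))
                  (*-congʳ (sym (fromℕ-suc k)))

  neg-unique : ∀ {x y} → x + y ≈ 0# → - y ≈ x
  neg-unique {x} {y} x+y≈0 = begin
    - y            ≈⟨ sym (+-identityˡ _) ⟩
    0# + - y       ≈⟨ +-congʳ (sym x+y≈0) ⟩
    (x + y) + - y  ≈⟨ solve 2 (λ x y → (x :+ y) :+ :- y := x) refl x y ⟩
    x              ∎

  -- The main estimate |e_k| ≤ μ^k, by strong induction on k: by Newton's
  -- identity and the convolution bound, (k+1) |e_{k+1}| ≤ (k+1) μ^{k+1}.
  elementary-bound : ∀ {m} (z : Fin m → Carrier) μ → NonNeg μ → ∣ ∑ z ∣≤ μ →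
                     ∑ (λ j → z j * z j) ≤ (μ * μ) → ∀ k → ∣ elementary z k ∣≤ pow F μ k
  elementary-bound z μ μ≥0 sum≤μ squares≤μ² = <-rec _ step
    where
    step : ∀ k → (∀ {j} → j < k → ∣ elementary z j ∣≤ pow F μ j) → ∣ elementary z k ∣≤ pow F μ k
    step zero    _  = abs-resp (sym (elementary-zero z)) refl (abs-refl nonneg-1)
    step (suc k) ih =
      abs-cancel k (abs-resp (neg-unique (newton z (suc k))) (*-congˡ (*-identityˡ _)) (abs-neg tail-bound))
      where
      tail-bound : ∣ conv (suc k) (elementary z) (negPowerSum z) ∣≤ fromℕ (suc k) * (1# * pow F μ (suc k))
      tail-bound = conv-bound (negPowerSum z) μ μ≥0 (negPowerSum-bound z μ μ≥0 sum≤μ squares≤μ²)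
                              (suc k) (elementary z) 1# nonneg-1
                              (λ j<k → abs-resp refl (sym (*-identityˡ _)) (ih j<k))

  sizeSum : ∀ {m} → (Fin m → Carrier) → ℕ → List (Subset m) → Carrier
  sizeSum z k L = foldr (λ p acc → prodSubset F z p + acc) 0# (filter (λ p → ∣ p ∣ ℕ.≟ k) L)

  sizeSum-++ : ∀ {m} (z : Fin m → Carrier) k xs ys → sizeSum z k (xs ++ ys) ≈ sizeSum z k xs + sizeSum z k ys
  sizeSum-++ z k []       ys = sym (+-identityˡ _)
  sizeSum-++ z k (p ∷ xs) ys with does (∣ p ∣ ℕ.≟ k)
  ... | false = sizeSum-++ z k xs ys
  ... | true  = trans (+-congˡ (sizeSum-++ z k xs ys)) (sym (+-assoc _ _ _))

  -- subsets containing the first index have positive size ...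
  sizeSum-inside-zero : ∀ {m} (z : Fin (suc m) → Carrier) L → sizeSum z 0 (map (inside ∷_) L) ≈ 0#
  sizeSum-inside-zero z []      = refl
  sizeSum-inside-zero z (p ∷ L) = sizeSum-inside-zero z L

  sizeSum-inside-suc : ∀ {m} (z : Fin (suc m) → Carrier) k L →
                       sizeSum z (suc k) (map (inside ∷_) L) ≈ z zero * sizeSum (λ j → z (suc j)) k L
  sizeSum-inside-suc z k []      = sym (zeroʳ _)
  sizeSum-inside-suc z k (p ∷ L) with does (∣ p ∣ ℕ.≟ k)
  ... | false = sizeSum-inside-suc z k L
  ... | true  = trans (+-congˡ (sizeSum-inside-suc z k L)) (sym (distribˡ _ _ _))

  sizeSum-outside : ∀ {m} (z : Fin (suc m) → Carrier) k L →
                    sizeSum z k (map (outside ∷_) L) ≈ sizeSum (λ j → z (suc j)) k L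
  sizeSum-outside z k []      = refl
  sizeSum-outside z k (p ∷ L) with does (∣ p ∣ ℕ.≟ k)
  ... | false = sizeSum-outside z k L
  ... | true  = +-congˡ (sizeSum-outside z k L)

  -- S_k satisfies the recursion defining the elementary symmetric polynomials
  S≈elementary : ∀ {m} (z : Fin m → Carrier) k → S F k z ≈ elementary z k
  S≈elementary {zero}  z zero    = +-identityʳ 1#
  S≈elementary {zero}  z (suc k) = refl
  S≈elementary {suc m} z zero    = begin
    S F 0 z
      ≈⟨ sizeSum-++ z 0 (map (inside ∷_) L) _ ⟩
    sizeSum z 0 (map (inside ∷_) L) + sizeSum z 0 (map (outside ∷_) L)
      ≈⟨ +-cong (sizeSum-inside-zero z L) (sizeSum-outside z 0 L) ⟩
    0# + S F 0 w
      ≈⟨ +-cong (sym (zeroʳ (z zero))) (S≈elementary w 0) ⟩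
    z zero * 0# + elementary w 0
      ≈⟨ +-comm _ _ ⟩
    elementary w 0 + z zero * 0# ∎
    where
    L = allSubsets m
    w = λ j → z (suc j)
  S≈elementary {suc m} z (suc k) = begin
    S F (suc k) z
      ≈⟨ sizeSum-++ z (suc k) (map (inside ∷_) L) _ ⟩
    sizeSum z (suc k) (map (inside ∷_) L) + sizeSum z (suc k) (map (outside ∷_) L)
      ≈⟨ +-cong (sizeSum-inside-suc z k L) (sizeSum-outside z (suc k) L) ⟩
    z zero * S F k w + S F (suc k) w
      ≈⟨ +-cong (*-congˡ (S≈elementary w k)) (S≈elementary w (suc k)) ⟩
    z zero * elementary w k + elementary w (suc k)
      ≈⟨ +-comm _ _ ⟩
    elementary w (suc k) + z zero * elementary w k ∎
    where
    L = allSubsets m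
    w = λ j → z (suc j)

-- S_k(z) is the recursively defined e_k, which is bounded by μ^k.
lemma3p6 : ∀ {c ℓ₁ ℓ₂} (F : OrderedField c ℓ₁ ℓ₂) → let open OrderedField F in
    (m : ℕ) (z : Fin m → Carrier) (μ : Carrier) →
    0# ≤ μ →
    AbsLe F (sumFin F z) μ →
    sumFin F (λ i → z i * z i) ≤ (μ * μ) →
    (k : ℕ) → 2 ≤ℕ k →
    AbsLe F (S F k z) (pow F μ k)
lemma3p6 F m z μ μ≥0 sum≤μ squares≤μ² k _ =
  abs-resp (sym (S≈elementary z k)) refl (elementary-bound z μ μ≥0 sum≤μ squares≤μ² k)
  where
  open OrderedField F using (sym; refl)
  open Bounds F
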